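{- Let $p$ be an odd prime, $m\ge 1$, and let $\mathcal{P}$ be an integral point set over $\mathbb{E}_p^m$. Then all non-degenerate simplices of $\mathcal{P}$ (i.e. all sets of $m+1$ points of $\mathcal{P}$ with $V_m^2\neq 0$) have the same characteristic.
   Context: Let $p$ be an odd prime, $\mathbb{Z}_p=\mathbb{Z}/p\mathbb{Z}$, $\alpha(p)$ the smallest quadratic non-residue modulo $p$, and $K=\mathbb{Z}_p(\sqrt{\alpha(p)})$ the quadratic extension field. $\mathbb{E}_p^m$ is modelled by $K^m$, and an integral point set over $\mathbb{E}_p^m$ is a set of points of $K^m$ such that for any two distinct points $x=(x_1,\dots,x_m),y=(y_1,\dots,y_m)$ there is $\delta(x,y)\in\mathbb{Z}_p\setminus\{0\}$ with $\sum_{i=1}^m(x_i-y_i)^2=\delta(x,y)^2$ (and $\delta(x,x)=0$). For $m+1$ points $v_1,\dots,v_{m+1}$ with $\delta_{i,j}=\delta(v_i,v_j)$ let $$V_m^2=\det\begin{pmatrix}\delta_{1,1}^2&\cdots&\delta_{1,m+1}^2&1\\ \vdots&\ddots&\vdots&\vdots\\ \delta_{m+1,1}^2&\cdots&\delta_{m+1,m+1}^2&1\\ 1&\cdots&1&0\end{pmatrix}\in\mathbb{Z}_p.$$ The simplex is non-degenerate if $V_m^2\neq0$, and then its characteristic is $1$ if $V_m^2$ is a quadratic residue in $\mathbb{Z}_p$ and $\alpha(p)$ otherwise. -}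

module Defs where

open import Data.Nat using (ℕ; zero; suc)
import Data.Nat as ℕ
open import Data.Nat.Primality using (Prime)
open import Data.Integer using (ℤ; +_; _+_; _-_; _*_; -_)
open import Data.Integer.Divisibility using (_∣_)
open import Data.Fin using (Fin; zero; suc; punchIn; toℕ)
open import Data.Maybe using (Maybe; just; nothing)
import Data.Maybe as Maybe
open import Data.Product using (_×_; _,_; proj₁; proj₂; ∃)
open import Data.Sum using (_⊎_)
open import Relation.Nullary using (¬_)
open import Relation.Binary.PropositionalEquality using (_≡_)

-- ℤ_p : integers considered modulo p (equality = congruence mod p)

infix 4 _≈[_]_ _≈K[_]_ _≈P[_]_
infixl 6 _+K_ _-K_

_≈[_]_ : ℤ → ℕ → ℤ → Set
a ≈[ p ] b = (+ p) ∣ (a - b)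

OddPrime : ℕ → Set
OddPrime p = Prime p × ¬ (p ≡ 2)

QR : ℕ → ℤ → Set
QR p a = ¬ (a ≈[ p ] + 0) × ∃ λ (x : ℤ) → (x * x) ≈[ p ] a

QNR : ℕ → ℤ → Set
QNR p a = ¬ (a ≈[ p ] + 0) × ¬ (∃ λ (x : ℤ) → (x * x) ≈[ p ] a)

IsSmallestQNR : ℕ → ℕ → Set
IsSmallestQNR p α = QNR p (+ α) × (∀ (b : ℕ) → 1 ℕ.≤ b → b ℕ.< α → ¬ QNR p (+ b))

-- K = ℤ_p(√α): an element (a , b) stands for a + b √α

K : Set
K = ℤ × ℤ

_≈K[_]_ : K → ℕ → K → Set
(a , b) ≈K[ p ] (c , d) = (a ≈[ p ] c) × (b ≈[ p ] d)

_-K_ : K → K → K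
(a , b) -K (c , d) = (a - c , b - d)

_+K_ : K → K → K
(a , b) +K (c , d) = (a + c , b + d)

mulK : ℕ → K → K → K
mulK α (a , b) (c , d) = (a * c + (+ α) * (b * d) , a * d + b * c)

ι : ℤ → K
ι a = (a , + 0)

Point : ℕ → Set
Point m = Fin m → K

_≈P[_]_ : ∀ {m} → Point m → ℕ → Point m → Set
x ≈P[ p ] y = ∀ i → x i ≈K[ p ] y i

sumK : ∀ {m} → (Fin m → K) → K
sumK {zero} f = ι (+ 0)
sumK {suc m} f = f zero +K sumK (λ i → f (suc i))

sqDist : ℕ → ∀ {m} → Point m → Point m → K
sqDist α x y = sumK (λ i → mulK α (x i -K y i) (x i -K y i))

-- Integral point sets over 𝔼_p^m: a set 𝒫 ⊆ K^m together with the
-- distance function δ : 𝒫 × 𝒫 → ℤ_p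

record IsIntegralPointSet (p α m : ℕ) (𝒫 : Point m → Set)
                          (δ : Point m → Point m → ℤ) : Set where
  field
    δ-self     : ∀ x → δ x x ≈[ p ] + 0
    δ-nonzero  : ∀ x y → 𝒫 x → 𝒫 y → ¬ (x ≈P[ p ] y) → ¬ (δ x y ≈[ p ] + 0)
    δ-distance : ∀ x y → 𝒫 x → 𝒫 y → ¬ (x ≈P[ p ] y) →
                 sqDist α x y ≈K[ p ] ι (δ x y * δ x y)

sumℤ : ∀ {n} → (Fin n → ℤ) → ℤ
sumℤ {zero} f = + 0
sumℤ {suc n} f = f zero + sumℤ (λ i → f (suc i))

sign : ℕ → ℤ
sign zero = + 1
sign (suc k) = - sign k

det : ∀ n → (Fin n → Fin n → ℤ) → ℤ
det zero M = + 1
det (suc n) M =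
  sumℤ (λ j → sign (toℕ j) * (M zero j * det n (λ r c → M (suc r) (punchIn j c))))

-- index i : Fin (suc n) ↦ just i for i < n, nothing for the last index n
initIdx : ∀ {n} → Fin (suc n) → Maybe (Fin n)
initIdx {zero} zero = nothing
initIdx {suc n} zero = just zero
initIdx {suc n} (suc i) = Maybe.map suc (initIdx i)

-- the Cayley–Menger matrix of m+1 points, entries δ(vᵢ,vⱼ)²; extra row/column of 1's, 0 corner
CM : ∀ {m} → (δ : Point m → Point m → ℤ) → (v : Fin (suc m) → Point m) →
     Fin (suc (suc m)) → Fin (suc (suc m)) → ℤ
CM δ v i j with initIdx i | initIdx j
... | just a  | just b  = δ (v a) (v b) * δ (v a) (v b)
... | just _  | nothing = + 1
... | nothing | just _  = + 1
... | nothing | nothing = + 0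

Vsq : ∀ {m} → (Point m → Point m → ℤ) → (Fin (suc m) → Point m) → ℤ
Vsq {m} δ v = det (suc (suc m)) (CM δ v)

IsSimplex : (p : ℕ) → ∀ {m} → (Point m → Set) → (Fin (suc m) → Point m) → Set
IsSimplex p {m} 𝒫 v = (∀ i → 𝒫 (v i)) × (∀ i j → ¬ (i ≡ j) → ¬ (v i ≈P[ p ] v j))

NonDegenerate : (p : ℕ) → ∀ {m} → (Point m → Point m → ℤ) → (Fin (suc m) → Point m) → Set
NonDegenerate p δ v = ¬ (Vsq δ v ≈[ p ] + 0)

HasCharacteristic : (p α : ℕ) → ∀ {m} → (Point m → Point m → ℤ) →
                    (Fin (suc m) → Point m) → ℕ → Set
HasCharacteristic p α δ v c =
  (QR p (Vsq δ v) × c ≡ 1) ⊎ (¬ QR p (Vsq δ v) × c ≡ α)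

-- Lift x ∈ K^m (K = ℤ_p(√α)) to P(x) = (‖x‖², 1, −2x) and Z(x) = (1, ‖x‖², x), so that
-- ⟨P(x), Z(y)⟩ = Σ (xᵢ − yᵢ)².  With border rows added, the Cayley–Menger matrix of a
-- simplex v is P(v)·Z(v)ᵀ and V²(v) = det P(v)·det Z(v); so for two simplices v, w
--     V²(v)·V²(w) = det (P(w)·Z(v)ᵀ) · det (P(v)·Z(w)ᵀ) = (det B)²,
-- B = P(w)·Z(v)ᵀ being the bordered matrix of squared distances from w to v.  These lie in
-- ℤ_p since 𝒫 is integral, so V²(v)·V²(w) is a square in ℤ_p and the two non-zero volumes
-- are both quadratic residues or both non-residues.

module Submission where

open import Defs
open import Data.Nat using (ℕ; suc; _≤_)
open import Data.Integer using (ℤ)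
open import Data.Fin using (Fin)
open import Relation.Binary.PropositionalEquality using (_≡_)

open import Algebra.Bundles using (CommutativeRing)
open import Algebra.Core using (Op₁; Op₂)
open import Algebra.Definitions using (Congruent₁; Congruent₂)
open import Algebra.Structures using (IsCommutativeRing)
open import Data.Empty using (⊥-elim)
open import Data.Fin as Fin using (zero; suc; punchIn; punchOut; toℕ; _≟_)
open import Data.Fin.Properties using (suc-injective; punchIn-punchOut)
open import Data.Integer as ℤ using (+_)
open import Data.Integer.DivMod using (_%ℕ_; _/ℕ_; a≡a%ℕn+[a/ℕn]*n; n%ℕd<d)
import Data.Integer.Divisibility.Signed as Signed
import Data.Integer.Properties as ℤP
open import Data.Integer.Tactic.RingSolver using (solve-∀)
open import Data.Maybe using (Maybe; just; nothing)
open import Data.Nat using (zero; NonZero; ≢-nonZero)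
import Data.Nat as ℕ
open import Data.Nat.Coprimality using (coprime-Bézout; prime⇒coprime)
open import Data.Nat.Divisibility using (_∣?_)
open import Data.Nat.GCD using (module Bézout)
open import Data.Nat.Primality using (Prime; prime⇒nonZero)
open import Data.Product using (_×_; _,_; proj₁; proj₂; ∃)
open import Data.Sum using (_⊎_; inj₁; inj₂)
open import Data.Vec.Functional using (Vector; _∷_; tail; insertAt; removeAt)
open import Data.Vec.Functional.Properties using (insertAt-lookup; insertAt-punchIn)
open import Function using (_∘_)
open import Level using (0ℓ; _⊔_)
open import Relation.Binary.Core using (Rel)
open import Relation.Binary.Definitions using (Decidable)
open import Relation.Binary.PropositionalEquality as ≡ using (_≢_; cong₂)
open import Relation.Binary.Structures using (IsEquivalence)
open import Relation.Nullary using (¬_; yes; no)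
import Relation.Nullary.Decidable as Dec
open import Relation.Nullary.Decidable using (decidable-stable)

-- Determinants over an arbitrary commutative ring, defined by Laplace expansion along the
-- first row: they are the alternating multilinear forms normalised at the identity, and
-- therefore multiplicative and invariant under transposition.
module Determinant {c ℓ} (R : CommutativeRing c ℓ) where

  open CommutativeRing R hiding (zero)
  open import Algebra.Properties.Ring ring using (-0#≈0#; +-inverseʳ-unique; -‿distribˡ-*; -1*x≈-x)
  open import Algebra.Properties.Semiring.Sum semiring
    using (sum; ∑-comm; ∑-distrib-+; *-distribˡ-sum; *-distribʳ-sum; sum-cong-≋; sum-replicate-zero)
  open import Data.Vec.Functional.Relation.Binary.Equality.Setoid setoid using (_≋_; ≋-refl; ≋-sym)
  open import Relation.Binary.Reasoning.Setoid setoid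
  open import Algebra.Solver.CommutativeMonoid *-commutativeMonoid using (solve; _⊜_; _⊕_)

  *-linear : ∀ s x y a b → s * (x * a + y * b) ≈ x * (s * a) + y * (s * b)
  *-linear s x y a b = trans (distribˡ s (x * a) (y * b)) (+-cong (lcomm s x a) (lcomm s y b))
    where
    lcomm : ∀ u v w → u * (v * w) ≈ v * (u * w)
    lcomm = solve 3 (λ u v w → u ⊕ (v ⊕ w) ⊜ v ⊕ (u ⊕ w)) refl

  *-linearʳ : ∀ x y a b d → (x * a + y * b) * d ≈ x * (a * d) + y * (b * d)
  *-linearʳ x y a b d = trans (distribʳ d (x * a) (y * b)) (+-cong (*-assoc x a d) (*-assoc y b d))

  annihilate : ∀ s a → s * (a * 0#) ≈ 0#
  annihilate s a = trans (*-congˡ (zeroʳ a)) (zeroʳ s)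

  term-vanishes : ∀ s a {d} → d ≈ 0# → s * (a * d) ≈ 0#
  term-vanishes s a d≈0 = trans (*-congˡ (*-congˡ d≈0)) (annihilate s a)

  one-zero : ∀ a → 1# * a + 0# * a ≈ a
  one-zero a = trans (+-cong (*-identityˡ a) (zeroˡ a)) (+-identityʳ a)

  sum-zero : ∀ {n} {f : Vector Carrier n} → (∀ i → f i ≈ 0#) → sum f ≈ 0#
  sum-zero {n} f≈0 = trans (sum-cong-≋ f≈0) (sum-replicate-zero n)

  sum-linear : ∀ {n} x y (f g : Vector Carrier n) →
               sum (λ j → x * f j + y * g j) ≈ x * sum f + y * sum g
  sum-linear x y f g = begin
    sum (λ j → x * f j + y * g j)             ≈⟨ ∑-distrib-+ (λ j → x * f j) (λ j → y * g j) ⟩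
    sum (λ j → x * f j) + sum (λ j → y * g j) ≈⟨ +-cong (*-distribˡ-sum x f) (*-distribˡ-sum y g) ⟨
    x * sum f + y * sum g                     ∎

  Rows : ℕ → ℕ → Set c
  Rows k n = Vector (Vector Carrier n) k

  Matrix : ℕ → Set c
  Matrix n = Rows n n

  infix 4 _≋ᴹ_
  _≋ᴹ_ : ∀ {k n} → Rows k n → Rows k n → Set ℓ
  X ≋ᴹ Y = ∀ i → X i ≋ Y i

  head-tail : ∀ {k n} (X : Rows (suc k) n) → X ≋ᴹ X zero ∷ tail X
  head-tail X zero    = ≋-refl
  head-tail X (suc i) = ≋-refl

  sgn : ℕ → Carrier
  sgn zero = 1#
  sgn (suc k) = - sgn k

  minor : ∀ {n} → Fin (suc n) → Matrix (suc n) → Matrix n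
  minor j M r = removeAt (M (suc r)) j

  Det : ∀ {n} → Matrix n → Carrier
  Det {zero} M = 1#
  Det {suc n} M = sum λ j → sgn (toℕ j) * (M zero j * Det (minor j M))

  det-cong : ∀ {n} {M N : Matrix n} → M ≋ᴹ N → Det M ≈ Det N
  det-cong {zero}  _   = refl
  det-cong {suc n} M≋N = sum-cong-≋ λ j →
    *-congˡ {sgn (toℕ j)} (*-cong (M≋N zero j) (det-cong λ r c → M≋N (suc r) (punchIn j c)))

  record RowCombination {k n} (r : Fin k) (x y : Carrier) (X Y Z : Rows k n) : Set ℓ where
    field
      left  : ∀ i → i ≢ r → X i ≋ Z i
      right : ∀ i → i ≢ r → Y i ≋ Z i
      row   : ∀ col → Z r col ≈ x * X r col + y * Y r col

  -- Forms on row families: linear in each row, vanishing on two equal rows, and compatible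
  -- with pointwise equality (for k ≥ 1 the latter follows from linearity).
  Multilinear : ∀ {k n} → (Rows k n → Carrier) → Set (c ⊔ ℓ)
  Multilinear D = ∀ {r x y X Y Z} → RowCombination r x y X Y Z → D Z ≈ x * D X + y * D Y

  Alternating : ∀ {k n} → (Rows k n → Carrier) → Set (c ⊔ ℓ)
  Alternating D = ∀ X {r s} → r ≢ s → X r ≋ X s → D X ≈ 0#

  Respects : ∀ {k n} → (Rows k n → Carrier) → Set (c ⊔ ℓ)
  Respects D = ∀ {X Y} → X ≋ᴹ Y → D X ≈ D Y

  record IsAlternatingForm {k n} (D : Rows k n → Carrier) : Set (c ⊔ ℓ) where
    field
      respects    : Respects D
      linear      : Multilinear D
      alternating : Alternating D

  -- Combinations in the first row, and combinations below a fixed extra first row; the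
  -- latter make D (v ∷ _) a form again whenever D is one.
  first-row-combination : ∀ {k n x y} {u v w : Vector Carrier n} (V : Rows k n) →
    (∀ c → w c ≈ x * u c + y * v c) → RowCombination zero x y (u ∷ V) (v ∷ V) (w ∷ V)
  first-row-combination V row = record
    { left  = λ { zero 0≢0 → ⊥-elim (0≢0 ≡.refl) ; (suc i) _ → ≋-refl }
    ; right = λ { zero 0≢0 → ⊥-elim (0≢0 ≡.refl) ; (suc i) _ → ≋-refl }
    ; row   = row
    }

  cons-combination : ∀ {k n r x y} {X Y Z : Rows k n} (v : Vector Carrier n) →
    RowCombination r x y X Y Z → RowCombination (suc r) x y (v ∷ X) (v ∷ Y) (v ∷ Z)
  cons-combination v comb = record
    { left  = λ { zero _ → ≋-refl ; (suc i) i≢r → left  i (i≢r ∘ ≡.cong suc) }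
    ; right = λ { zero _ → ≋-refl ; (suc i) i≢r → right i (i≢r ∘ ≡.cong suc) }
    ; row   = row
    }
    where open RowCombination comb

  cons-respects : ∀ {k n} {D : Rows (suc k) n → Carrier} (v : Vector Carrier n) →
                  Respects D → Respects (λ Y → D (v ∷ Y))
  cons-respects v resp Y≋Y′ = resp λ { zero → ≋-refl ; (suc i) → Y≋Y′ i }

  minor-combination : ∀ {n r x y} {X Y Z : Matrix (suc n)} j →
    RowCombination (suc r) x y X Y Z → RowCombination r x y (minor j X) (minor j Y) (minor j Z)
  minor-combination j comb = record
    { left  = λ i i≢r c → left  (suc i) (i≢r ∘ suc-injective) (punchIn j c)
    ; right = λ i i≢r c → right (suc i) (i≢r ∘ suc-injective) (punchIn j c)
    ; row   = λ c → row (punchIn j c)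
    }
    where open RowCombination comb

  laplace : ∀ {n} → Matrix (suc n) → Vector Carrier (suc n)
  laplace M j = sgn (toℕ j) * (M zero j * Det (minor j M))

  -- A combination in row 0 combines the entries of row 0 while the minors stay fixed;
  -- a combination in a lower row is a combination in every minor.
  det-linear : ∀ {n} → Multilinear (Det {n})
  det-linear {zero} {r = ()}
  det-linear {suc n} {x = x} {y} {X} {Y} comb =
    trans (sum-cong-≋ (terms comb)) (sum-linear x y (laplace X) (laplace Y))
    where
    terms : ∀ {r Z} → RowCombination r x y X Y Z → ∀ j → laplace Z j ≈ x * laplace X j + y * laplace Y j
    terms {zero} {Z} comb j = begin
      s * (Z zero j * Det (minor j Z))
        ≈⟨ *-congˡ (*-cong (row j) (det-cong λ r c → sym (left (suc r) (λ ()) (punchIn j c)))) ⟩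
      s * ((x * X zero j + y * Y zero j) * Det (minor j X))
        ≈⟨ *-congˡ (*-linearʳ x y (X zero j) (Y zero j) (Det (minor j X))) ⟩
      s * (x * (X zero j * Det (minor j X)) + y * (Y zero j * Det (minor j X)))
        ≈⟨ *-linear s x y _ _ ⟩
      x * laplace X j + y * (s * (Y zero j * Det (minor j X)))
        ≈⟨ +-congˡ (*-congˡ (*-congˡ (*-congˡ (det-cong λ r c →
             trans (left (suc r) (λ ()) (punchIn j c)) (sym (right (suc r) (λ ()) (punchIn j c))))))) ⟩
      x * laplace X j + y * laplace Y j  ∎
      where
      open RowCombination comb
      s = sgn (toℕ j)
    terms {suc r} {Z} comb j = begin
      s * (Z zero j * Det (minor j Z))
        ≈⟨ *-congˡ (*-congˡ (det-linear (minor-combination j comb))) ⟩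
      s * (Z zero j * (x * Det (minor j X) + y * Det (minor j Y)))
        ≈⟨ *-congˡ (*-linear (Z zero j) x y _ _) ⟩
      s * (x * (Z zero j * Det (minor j X)) + y * (Z zero j * Det (minor j Y)))
        ≈⟨ *-linear s x y _ _ ⟩
      x * (s * (Z zero j * Det (minor j X))) + y * (s * (Z zero j * Det (minor j Y)))
        ≈⟨ +-cong (*-congˡ (*-congˡ (*-congʳ (≋-sym (left zero (λ ())) j))))
                  (*-congˡ (*-congˡ (*-congʳ (≋-sym (right zero (λ ())) j)))) ⟩
      x * laplace X j + y * laplace Y j  ∎
      where
      open RowCombination comb
      s = sgn (toℕ j)

  cminor : ∀ {n} → Fin (suc n) → Matrix (suc n) → Matrix n
  cminor i M r c = M (punchIn i r) (suc c)

  scale-sum : ∀ {n} u v (f : Vector Carrier n) → - u * (v * sum f) ≈ sum λ i → - (u * (v * f i))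
  scale-sum u v f = begin
    - u * (v * sum f)              ≈⟨ *-congˡ (*-distribˡ-sum v f) ⟩
    - u * sum (λ i → v * f i)      ≈⟨ *-distribˡ-sum (- u) (λ i → v * f i) ⟩
    sum (λ i → - u * (v * f i))    ≈⟨ sum-cong-≋ (λ i → -‿distribˡ-* u (v * f i)) ⟨
    sum (λ i → - (u * (v * f i)))  ∎

  double-sum-swap : ∀ {m n} (s a : Vector Carrier m) (t b : Vector Carrier n)
                    (d : Fin n → Fin m → Carrier) →
    sum (λ j → - s j * (a j * sum λ i → t i * (b i * d i j))) ≈
    sum (λ i → - t i * (b i * sum λ j → s j * (a j * d i j)))
  double-sum-swap s a t b d = begin
    sum (λ j → - s j * (a j * sum λ i → t i * (b i * d i j)))
      ≈⟨ sum-cong-≋ (λ j → scale-sum (s j) (a j) (λ i → t i * (b i * d i j))) ⟩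
    sum (λ j → sum λ i → - (s j * (a j * (t i * (b i * d i j)))))
      ≈⟨ ∑-comm (λ j i → - (s j * (a j * (t i * (b i * d i j))))) ⟩
    sum (λ i → sum λ j → - (s j * (a j * (t i * (b i * d i j)))))
      ≈⟨ sum-cong-≋ (λ i → sum-cong-≋ λ j → -‿cong (exchange (s j) (a j) (t i) (b i) (d i j))) ⟩
    sum (λ i → sum λ j → - (t i * (b i * (s j * (a j * d i j)))))
      ≈⟨ sum-cong-≋ (λ i → scale-sum (t i) (b i) (λ j → s j * (a j * d i j))) ⟨
    sum (λ i → - t i * (b i * sum λ j → s j * (a j * d i j))) ∎
    where
    exchange : ∀ s a t b d → s * (a * (t * (b * d))) ≈ t * (b * (s * (a * d)))
    exchange = solve 5 (λ s a t b d → s ⊕ (a ⊕ (t ⊕ (b ⊕ d))) ⊜ t ⊕ (b ⊕ (s ⊕ (a ⊕ d)))) refl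

  -- Expansion along the first column: by induction, expanding each minor along its first
  -- column and exchanging the order of summation.
  det-column : ∀ {n} (M : Matrix (suc n)) →
               Det M ≈ sum λ i → sgn (toℕ i) * (M i zero * Det (cminor i M))
  det-column {zero} M = refl
  det-column {suc n} M = +-congˡ (trans
    (sum-cong-≋ λ j →
      *-congˡ {sgn (toℕ (suc j))} (*-congˡ {M zero (suc j)} (det-column (minor (suc j) M))))
    (double-sum-swap (sgn ∘ toℕ) (M zero ∘ suc) (sgn ∘ toℕ) (λ i → M (suc i) zero)
                     (λ i j → Det λ r c → M (suc (punchIn i r)) (suc (punchIn j c)))))

  -- Transposition: row expansion of Mᵀ is column expansion of M.
  _ᵀ : ∀ {n} → Matrix n → Matrix n
  (M ᵀ) i j = M j i

  det-transpose : ∀ {n} (M : Matrix n) → Det (M ᵀ) ≈ Det M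
  det-transpose {zero} M = refl
  det-transpose {suc n} M =
    trans (sum-cong-≋ λ j → *-congˡ {sgn (toℕ j)} (*-congˡ {M j zero} (det-transpose (cminor j M))))
          (sym (det-column M))

  first-terms-cancel : ∀ {a a′ d d′} → a ≈ a′ → d ≈ d′ →
                       1# * (a * d) + (- 1# * (a′ * d′) + 0#) ≈ 0#
  first-terms-cancel {a} {a′} {d} {d′} a≈a′ d≈d′ = begin
    1# * (a * d) + (- 1# * (a′ * d′) + 0#) ≈⟨ +-cong (*-identityˡ _) (+-identityʳ _) ⟩
    a * d + - 1# * (a′ * d′)                ≈⟨ +-congˡ (-1*x≈-x _) ⟩
    a * d + - (a′ * d′)                     ≈⟨ +-congˡ (-‿cong (*-cong a≈a′ d≈d′)) ⟨
    a * d + - (a * d)                       ≈⟨ -‿inverseʳ _ ⟩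
    0#                                      ∎

  -- Equal first two rows: in the column expansion the first two terms cancel,
  -- and every further cofactor again has two equal first rows.
  mutual
    det-first-rows-equal : ∀ {n} (M : Matrix (suc (suc n))) → M zero ≋ M (suc zero) → Det M ≈ 0#
    det-first-rows-equal M eq =
      trans (det-column M) (trans (+-congˡ (+-congˡ (later-terms-vanish M eq)))
                                  (first-terms-cancel (eq zero) (det-cong cminors-equal)))
      where
      cminors-equal : cminor zero M ≋ᴹ cminor (suc zero) M
      cminors-equal zero    c = sym (eq (suc c))
      cminors-equal (suc r) c = refl

    later-terms-vanish : ∀ {n} (M : Matrix (suc (suc n))) → M zero ≋ M (suc zero) →
      sum (λ i → sgn (toℕ (suc (suc i))) * (M (suc (suc i)) zero * Det (cminor (suc (suc i)) M))) ≈ 0#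
    later-terms-vanish {zero}  M eq = refl
    later-terms-vanish {suc n} M eq = sum-zero λ i →
      term-vanishes (sgn (toℕ (suc (suc i)))) (M (suc (suc i)) zero)
                    (det-first-rows-equal (cminor (suc (suc i)) M) (λ c → eq (suc c)))

  swap-first-rows : ∀ {k n} (D : Rows (suc (suc k)) n → Carrier) → Multilinear D →
                    (∀ u R → D (u ∷ u ∷ R) ≈ 0#) → ∀ u w R → D (w ∷ u ∷ R) ≈ - D (u ∷ w ∷ R)
  swap-first-rows D lin vanish u w R = +-inverseʳ-unique (D (u ∷ w ∷ R)) (D (w ∷ u ∷ R)) opposite
    where
    s : Vector Carrier _
    s c = 1# * u c + 1# * w c
    in-first : ∀ V → D (s ∷ V) ≈ 1# * D (u ∷ V) + 1# * D (w ∷ V)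
    in-first V = lin (first-row-combination V λ _ → refl)
    in-second : ∀ v → D (v ∷ s ∷ R) ≈ 1# * D (v ∷ u ∷ R) + 1# * D (v ∷ w ∷ R)
    in-second v = lin (cons-combination v (first-row-combination R λ _ → refl))
    simplify : ∀ {p q z z′} → z ≈ 0# → z′ ≈ 0# →
               1# * (1# * z + 1# * p) + 1# * (1# * q + 1# * z′) ≈ p + q
    simplify {p} {q} {z} {z′} z≈0 z′≈0 = begin
      1# * (1# * z + 1# * p) + 1# * (1# * q + 1# * z′)
        ≈⟨ +-cong (trans (*-identityˡ _) (+-cong (*-identityˡ z) (*-identityˡ p)))
                  (trans (*-identityˡ _) (+-cong (*-identityˡ q) (*-identityˡ z′))) ⟩
      (z + p) + (q + z′)
        ≈⟨ +-cong (trans (+-congʳ z≈0) (+-identityˡ p)) (trans (+-congˡ z′≈0) (+-identityʳ q)) ⟩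
      p + q                ∎
    opposite : D (u ∷ w ∷ R) + D (w ∷ u ∷ R) ≈ 0#
    opposite = begin
      D (u ∷ w ∷ R) + D (w ∷ u ∷ R)
        ≈⟨ simplify (vanish u R) (vanish w R) ⟨
      1# * (1# * D (u ∷ u ∷ R) + 1# * D (u ∷ w ∷ R)) + 1# * (1# * D (w ∷ u ∷ R) + 1# * D (w ∷ w ∷ R))
        ≈⟨ +-cong (*-congˡ (in-second u)) (*-congˡ (in-second w)) ⟨
      1# * D (u ∷ s ∷ R) + 1# * D (w ∷ s ∷ R)
        ≈⟨ in-first (s ∷ R) ⟨
      D (s ∷ s ∷ R)
        ≈⟨ vanish s R ⟩
      0#  ∎

  det-swap : ∀ {n} u w (R : Rows n (suc (suc n))) → Det (w ∷ u ∷ R) ≈ - Det (u ∷ w ∷ R)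
  det-swap = swap-first-rows Det det-linear (λ u R → det-first-rows-equal (u ∷ u ∷ R) (λ _ → refl))

  -- Two equal rows.  Rows 0 and s+1 are reduced, by exchanging rows 0 and 1, to two equal
  -- rows below the first, which are equal rows in every minor.
  mutual
    det-alternating : ∀ {n} → Alternating (Det {n})
    det-alternating M {zero}  {zero}  0≢0 _  = ⊥-elim (0≢0 ≡.refl)
    det-alternating M {zero}  {suc s} _   eq = first-row-repeated M s eq
    det-alternating M {suc r} {zero}  _   eq = first-row-repeated M r (≋-sym eq)
    det-alternating M {suc r} {suc s} r≢s eq = lower-rows-repeated M (r≢s ∘ ≡.cong suc) eq

    first-row-repeated : ∀ {n} (M : Matrix (suc n)) s → M zero ≋ M (suc s) → Det M ≈ 0#
    first-row-repeated M zero eq = det-first-rows-equal M eq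
    first-row-repeated M (suc s) eq = begin
      Det M                                 ≈⟨ det-cong {M = M} {N = M₀ ∷ M₁ ∷ rows} unfold ⟩
      Det (M₀ ∷ M₁ ∷ rows)                  ≈⟨ det-swap M₁ M₀ rows ⟩
      - Det (M₁ ∷ M₀ ∷ rows)                ≈⟨ -‿cong (lower-rows-repeated (M₁ ∷ M₀ ∷ rows) {zero} {suc s} (λ ()) eq) ⟩
      - 0#                                  ≈⟨ -0#≈0# ⟩
      0#                                    ∎
      where
      M₀ = M zero
      M₁ = M (suc zero)
      rows = λ i → M (suc (suc i))
      unfold : M ≋ᴹ M₀ ∷ M₁ ∷ rows
      unfold zero          = ≋-refl
      unfold (suc zero)    = ≋-refl
      unfold (suc (suc i)) = ≋-refl

    lower-rows-repeated : ∀ {n} (M : Matrix (suc n)) {r s} → r ≢ s → M (suc r) ≋ M (suc s) → Det M ≈ 0#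
    lower-rows-repeated M r≢s eq = sum-zero λ j →
      term-vanishes (sgn (toℕ j)) (M zero j) (det-alternating (minor j M) r≢s (λ c → eq (punchIn j c)))

  unit : ∀ {n} → Fin n → Vector Carrier n
  unit zero    zero    = 1#
  unit zero    (suc _) = 0#
  unit (suc _) zero    = 0#
  unit (suc i) (suc j) = unit i j

  unit-diagonal : ∀ {n} (i : Fin n) → unit i i ≡ 1#
  unit-diagonal zero    = ≡.refl
  unit-diagonal (suc i) = unit-diagonal i

  unit-off-row : ∀ {n} (j : Fin (suc n)) c → unit j (punchIn j c) ≡ 0#
  unit-off-row zero    c       = ≡.refl
  unit-off-row (suc j) zero    = ≡.refl
  unit-off-row (suc j) (suc c) = unit-off-row j c

  unit-off-column : ∀ {n} (j : Fin (suc n)) r → unit (punchIn j r) j ≡ 0#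
  unit-off-column zero    r       = ≡.refl
  unit-off-column (suc j) zero    = ≡.refl
  unit-off-column (suc j) (suc r) = unit-off-column j r

  unit-punchIn : ∀ {n} (j : Fin (suc n)) r c → unit (punchIn j r) (punchIn j c) ≡ unit r c
  unit-punchIn zero    r       c       = ≡.refl
  unit-punchIn (suc j) zero    zero    = ≡.refl
  unit-punchIn (suc j) zero    (suc c) = ≡.refl
  unit-punchIn (suc j) (suc r) zero    = ≡.refl
  unit-punchIn (suc j) (suc r) (suc c) = unit-punchIn j r c

  sum-unit : ∀ {n} (i : Fin n) (g : Vector Carrier n) → sum (λ k → unit i k * g k) ≈ g i
  sum-unit zero    g = trans (+-cong (*-identityˡ _) (sum-zero λ k → zeroˡ (g (suc k)))) (+-identityʳ _)
  sum-unit (suc i) g = trans (+-cong (zeroˡ _) (sum-unit i (tail g))) (+-identityˡ _)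

  LinearFunctional : ∀ {n} → (Vector Carrier n → Carrier) → Set (c ⊔ ℓ)
  LinearFunctional F = ∀ {x y u v w} → (∀ c → w c ≈ x * u c + y * v c) → F w ≈ x * F u + y * F v

  expand-by-units : ∀ {n} (F : Vector Carrier n → Carrier) → LinearFunctional F →
                    ∀ u → F u ≈ sum λ j → u j * F (unit j)
  expand-by-units {zero} F lin u = begin
    F u                 ≈⟨ lin {0#} {0#} {u} {u} (λ ()) ⟩
    0# * F u + 0# * F u ≈⟨ +-cong (zeroˡ _) (zeroˡ _) ⟩
    0# + 0#             ≈⟨ +-identityʳ 0# ⟩
    0#                  ∎
  expand-by-units {suc n} F lin u = begin
    F u
      ≈⟨ lin split ⟩
    u zero * F (unit zero) + 1# * F′ (tail u)
      ≈⟨ +-congˡ (*-identityˡ _) ⟩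
    u zero * F (unit zero) + F′ (tail u)
      ≈⟨ +-congˡ (expand-by-units F′ (lin ∘ zero-first) (tail u)) ⟩
    u zero * F (unit zero) + sum (λ j → u (suc j) * F′ (unit j))
      ≈⟨ +-congˡ (sum-cong-≋ λ j → *-congˡ {u (suc j)} (shift j)) ⟩
    u zero * F (unit zero) + sum (λ j → u (suc j) * F (unit (suc j))) ∎
    where
    F′ = λ v → F (0# ∷ v)
    split : ∀ c → u c ≈ u zero * unit zero c + 1# * (0# ∷ tail u) c
    split zero    = sym (trans (+-cong (*-identityʳ _) (zeroʳ _)) (+-identityʳ _))
    split (suc c) = sym (trans (+-cong (zeroʳ _) (*-identityˡ _)) (+-identityˡ _))
    zero-first : ∀ {x y u v w} → (∀ c → w c ≈ x * u c + y * v c) →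
                 ∀ c → (0# ∷ w) c ≈ x * (0# ∷ u) c + y * (0# ∷ v) c
    zero-first {x} {y} _ zero    = sym (trans (+-cong (zeroʳ x) (zeroʳ y)) (+-identityʳ 0#))
    zero-first         h (suc c) = h c
    shift : ∀ j → F′ (unit j) ≈ F (unit (suc j))
    shift j = trans (lin {1#} {0#} {unit (suc j)} {unit (suc j)} λ c → trans (pointwise c) (sym (one-zero _)))
                    (one-zero (F (unit (suc j))))
      where
      pointwise : ∀ c → (0# ∷ unit j) c ≈ unit (suc j) c
      pointwise zero    = refl
      pointwise (suc c) = refl

  agree-split : ∀ {n} j {u v : Vector Carrier (suc n)} →
                u j ≈ v j → (∀ c → u (punchIn j c) ≈ v (punchIn j c)) → u ≋ v
  agree-split j {u} {v} at away c with j ≟ c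
  ... | yes ≡.refl = at
  ... | no j≢c     = ≡.subst (λ k → u k ≈ v k) (punchIn-punchOut j≢c) (away (punchOut j≢c))

  pad : ∀ {n} → Fin (suc n) → Vector Carrier n → Vector Carrier (suc n)
  pad j u = insertAt u j 0#

  pad-characterisation : ∀ {n} j {u : Vector Carrier n} {w} →
                         0# ≈ w j → (∀ c → u c ≈ w (punchIn j c)) → pad j u ≋ w
  pad-characterisation j {u} at away = agree-split j
    (trans (reflexive (insertAt-lookup u j 0#)) at)
    (λ c → trans (reflexive (insertAt-punchIn u j 0# c)) (away c))

  pad-cong : ∀ {n} j {u v : Vector Carrier n} → u ≋ v → pad j u ≋ pad j v
  pad-cong j {u} {v} u≋v = pad-characterisation j
    (sym (reflexive (insertAt-lookup v j 0#)))
    (λ c → trans (u≋v c) (sym (reflexive (insertAt-punchIn v j 0# c))))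

  pad-rows-combination : ∀ {k n r x y} {X Y Z : Rows k n} j →
    RowCombination r x y X Y Z → RowCombination r x y (pad j ∘ X) (pad j ∘ Y) (pad j ∘ Z)
  pad-rows-combination {x = x} {y} {X} {Y} j comb = record
    { left  = λ i i≢r → pad-cong j (left i i≢r)
    ; right = λ i i≢r → pad-cong j (right i i≢r)
    ; row   = pad-characterisation j
        (sym (trans (+-cong (*-congˡ (reflexive (insertAt-lookup _ j 0#)))
                            (*-congˡ (reflexive (insertAt-lookup _ j 0#))))
                    (trans (+-cong (zeroʳ x) (zeroʳ y)) (+-identityʳ 0#))))
        (λ c → trans (row c) (sym (+-cong (*-congˡ (reflexive (insertAt-punchIn _ j 0# c)))
                                          (*-congˡ (reflexive (insertAt-punchIn _ j 0# c))))))
    }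
    where open RowCombination comb

  embed : ∀ {n} → Fin (suc n) → (Matrix (suc n) → Carrier) → Matrix n → Carrier
  embed j D Y = D (unit j ∷ pad j ∘ Y)

  embed-form : ∀ {n} j {D : Matrix (suc n) → Carrier} → IsAlternatingForm D → IsAlternatingForm (embed j D)
  embed-form j form = record
    { respects    = λ X≋Y → respects λ { zero → ≋-refl ; (suc i) → pad-cong j (X≋Y i) }
    ; linear      = λ comb → linear (cons-combination (unit j) (pad-rows-combination j comb))
    ; alternating = λ X r≢s eq → alternating _ (r≢s ∘ suc-injective) (pad-cong j eq)
    }
    where open IsAlternatingForm form

  row-to-top : ∀ {n} → Fin (suc n) → Matrix (suc n)
  row-to-top j = unit j ∷ λ r → unit (punchIn j r)

  form-row-to-top : ∀ {n} (D : Matrix (suc n) → Carrier) → IsAlternatingForm D →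
                    ∀ j → D (row-to-top j) ≈ sgn (toℕ j) * D unit
  form-row-to-top D form zero =
    trans (respects {Y = unit} λ { zero → ≋-refl ; (suc r) → ≋-refl }) (sym (*-identityˡ _))
    where open IsAlternatingForm form
  form-row-to-top {suc n} D form (suc j) = begin
    D (row-to-top (suc j))
      ≈⟨ respects first-two ⟩
    D (unit (suc j) ∷ unit zero ∷ rest)
      ≈⟨ swap-first-rows D linear repeated (unit zero) (unit (suc j)) rest ⟩
    - D (unit zero ∷ unit (suc j) ∷ rest)
      ≈⟨ -‿cong (respects shifted) ⟩
    - embed zero D (row-to-top j)
      ≈⟨ -‿cong (form-row-to-top (embed zero D) (embed-form zero form) j) ⟩
    - (sgn (toℕ j) * embed zero D unit)
      ≈⟨ -‿cong (*-congˡ (respects identity)) ⟩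
    - (sgn (toℕ j) * D unit)
      ≈⟨ -‿distribˡ-* (sgn (toℕ j)) (D unit) ⟩
    - sgn (toℕ j) * D unit ∎
    where
    open IsAlternatingForm form
    rest = λ r → unit (suc (punchIn j r))
    repeated : ∀ u R → D (u ∷ u ∷ R) ≈ 0#
    repeated u R = alternating (u ∷ u ∷ R) {zero} {suc zero} (λ ()) ≋-refl
    first-two : row-to-top (suc j) ≋ᴹ unit (suc j) ∷ unit zero ∷ rest
    first-two zero          = ≋-refl
    first-two (suc zero)    = ≋-refl
    first-two (suc (suc r)) = ≋-refl
    shifted : unit zero ∷ unit (suc j) ∷ rest ≋ᴹ unit zero ∷ pad zero ∘ row-to-top j
    shifted zero                  = ≋-refl
    shifted (suc zero)    zero    = refl
    shifted (suc zero)    (suc c) = refl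
    shifted (suc (suc r)) zero    = refl
    shifted (suc (suc r)) (suc c) = refl
    identity : unit zero ∷ pad zero ∘ unit ≋ᴹ unit
    identity zero          = ≋-refl
    identity (suc r) zero    = refl
    identity (suc r) (suc c) = refl

  shear-invariant : ∀ {k n} (D : Rows k n → Carrier) → Respects D → Multilinear D →
                    (u : Vector Carrier n) → (∀ X r → X r ≋ u → D X ≈ 0#) →
                    ∀ X (t : Vector Carrier k) → D (λ r c → X r c + t r * u c) ≈ D X
  shear-invariant {zero}  D resp lin u vanish X t = resp (λ ())
  shear-invariant {suc k} D resp lin u vanish X t = begin
    D X′
      ≈⟨ resp (head-tail X′) ⟩
    D (X′ zero ∷ tail X′)
      ≈⟨ lin (first-row-combination (tail X′) λ c → +-congʳ (sym (*-identityˡ (X zero c)))) ⟩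
    1# * D (X zero ∷ tail X′) + t zero * D (u ∷ tail X′)
      ≈⟨ +-cong (*-identityˡ _) (trans (*-congˡ (vanish (u ∷ tail X′) zero ≋-refl)) (zeroʳ _)) ⟩
    D (X zero ∷ tail X′) + 0#
      ≈⟨ +-identityʳ _ ⟩
    D (X zero ∷ tail X′)
      ≈⟨ shear-invariant D′ (cons-respects (X zero) resp) (lin ∘ cons-combination (X zero))
                         u vanish′ (tail X) (tail t) ⟩
    D (X zero ∷ tail X)
      ≈⟨ resp (head-tail X) ⟨
    D X ∎
    where
    X′ : Rows (suc k) _
    X′ r c = X r c + t r * u c
    D′ = λ Y → D (X zero ∷ Y)
    vanish′ : ∀ Y r → Y r ≋ u → D′ Y ≈ 0#
    vanish′ Y r = vanish (X zero ∷ Y) (suc r)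

  det-unique : ∀ {n} (D : Matrix n → Carrier) → IsAlternatingForm D → ∀ M → D M ≈ Det M * D unit
  det-unique {zero} D form M = trans (respects (λ ())) (sym (*-identityˡ _))
    where open IsAlternatingForm form
  det-unique {suc n} D form M = begin
    D M
      ≈⟨ respects (head-tail M) ⟩
    D (M zero ∷ lower)
      ≈⟨ expand-by-units (λ u → D (u ∷ lower)) (λ eq → linear (first-row-combination lower eq)) (M zero) ⟩
    sum (λ j → M zero j * D (unit j ∷ lower))
      ≈⟨ sum-cong-≋ (λ j → *-congˡ {M zero j} (unit-first-row j)) ⟩
    sum (λ j → M zero j * (Det (minor j M) * (sgn (toℕ j) * D unit)))
      ≈⟨ sum-cong-≋ (λ j → rearrange (M zero j) (Det (minor j M)) (sgn (toℕ j)) (D unit)) ⟩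
    sum (λ j → laplace M j * D unit)
      ≈⟨ *-distribʳ-sum (D unit) (laplace M) ⟨
    Det M * D unit ∎
    where
    open IsAlternatingForm form
    lower = tail M
    rearrange : ∀ a d s e → a * (d * (s * e)) ≈ s * (a * d) * e
    rearrange = solve 4 (λ a d s e → a ⊕ (d ⊕ (s ⊕ e)) ⊜ (s ⊕ (a ⊕ d)) ⊕ e) refl
    -- subtracting multiples of the first row e_j clears column j, leaving the padded minor
    cleared : ∀ j r → pad j (minor j M r) ≋ λ c → lower r c + - lower r j * unit j c
    cleared j r = pad-characterisation j
      (sym (trans (+-congˡ (trans (*-congˡ (reflexive (unit-diagonal j))) (*-identityʳ _))) (-‿inverseʳ _)))
      (λ c → sym (trans (+-congˡ (trans (*-congˡ (reflexive (unit-off-row j c))) (zeroʳ _))) (+-identityʳ _)))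
    unit-first-row : ∀ j → D (unit j ∷ lower) ≈ Det (minor j M) * (sgn (toℕ j) * D unit)
    unit-first-row j = begin
      D (unit j ∷ lower)
        ≈⟨ shear-invariant (λ X → D (unit j ∷ X)) (cons-respects (unit j) respects)
             (linear ∘ cons-combination (unit j)) (unit j) repeats lower (λ r → - lower r j) ⟨
      D (unit j ∷ λ r c → lower r c + - lower r j * unit j c)
        ≈⟨ respects (λ { zero → ≋-refl ; (suc r) → ≋-sym (cleared j r) }) ⟩
      embed j D (minor j M)
        ≈⟨ det-unique (embed j D) (embed-form j form) (minor j M) ⟩
      Det (minor j M) * embed j D unit
        ≈⟨ *-congˡ (respects moved) ⟩
      Det (minor j M) * D (row-to-top j)
        ≈⟨ *-congˡ (form-row-to-top D form j) ⟩
      Det (minor j M) * (sgn (toℕ j) * D unit) ∎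
      where
      repeats : ∀ X r → X r ≋ unit j → D (unit j ∷ X) ≈ 0#
      repeats X r eq = alternating (unit j ∷ X) {zero} {suc r} (λ ()) (≋-sym eq)
      moved : unit j ∷ pad j ∘ unit ≋ᴹ row-to-top j
      moved zero    = ≋-refl
      moved (suc r) = pad-characterisation j (sym (reflexive (unit-off-column j r)))
                                             (λ c → sym (reflexive (unit-punchIn j r c)))

  -- Matrix product.  Multiplicativity: X ↦ Det (X · B) is an alternating form, hence
  -- equal to Det X · Det (1 · B).
  infixl 7 _·_
  _·_ : ∀ {n} → Matrix n → Matrix n → Matrix n
  (A · B) i j = sum λ k → A i k * B k j

  det-· : ∀ {n} (A B : Matrix n) → Det (A · B) ≈ Det A * Det B
  det-· A B = begin
    Det (A · B)             ≈⟨ det-unique (λ X → Det (X · B)) form A ⟩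
    Det A * Det (unit · B)  ≈⟨ *-congˡ (det-cong λ i j → sum-unit i (λ k → B k j)) ⟩
    Det A * Det B           ∎
    where
    form : IsAlternatingForm (λ X → Det (X · B))
    form = record
      { respects    = λ X≋Y → det-cong λ i j → sum-cong-≋ λ k → *-congʳ (X≋Y i k)
      ; linear      = λ {r} {x} {y} {X} {Y} comb → let open RowCombination comb in det-linear record
          { left  = λ i i≢r j → sum-cong-≋ λ k → *-congʳ (left i i≢r k)
          ; right = λ i i≢r j → sum-cong-≋ λ k → *-congʳ (right i i≢r k)
          ; row   = λ j → trans (sum-cong-≋ λ k → trans (*-congʳ (row k))
                                                          (*-linearʳ x y (X r k) (Y r k) (B k j)))
                                (sum-linear x y (λ k → X r k * B k j) (λ k → Y r k * B k j))
          }
      ; alternating = λ X r≢s eq → det-alternating (X · B) r≢s λ j → sum-cong-≋ λ k → *-congʳ (eq k)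
      }

  det-·ᵀ : ∀ {n} (A B : Matrix n) → Det (A · B ᵀ) ≈ Det A * Det B
  det-·ᵀ A B = trans (det-· A (B ᵀ)) (*-congˡ (det-transpose B))

module Lifting {c ℓ} (R : CommutativeRing c ℓ) (m : ℕ) where

  open CommutativeRing R hiding (zero)
  open Determinant R
  open import Data.Vec.Functional.Relation.Binary.Equality.Setoid setoid using (_≋_)
  open import Algebra.Properties.Ring ring using (-‿distribˡ-*; -‿distribʳ-*; -‿involutive; -‿+-comm)
  open import Algebra.Properties.Semiring.Sum semiring using (sum; sum-cong-≋; ∑-distrib-+)
  open import Algebra.Solver.CommutativeMonoid +-commutativeMonoid as +-Solver using ()
  open import Algebra.Solver.CommutativeMonoid *-commutativeMonoid as ×-Solver using ()
  open import Relation.Binary.Reasoning.Setoid setoid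

  Pt : Set c
  Pt = Vector Carrier m

  ‖_‖² : Pt → Carrier
  ‖ x ‖² = sum λ k → x k * x k

  dist² : Pt → Pt → Carrier
  dist² x y = sum λ k → (x k + - y k) * (x k + - y k)

  square-of-difference : ∀ a b → (a + - b) * (a + - b) ≈ a * a + (b * b + - (a + a) * b)
  square-of-difference a b = begin
    (a + - b) * (a + - b)                        ≈⟨ distribʳ (a + - b) a (- b) ⟩
    a * (a + - b) + - b * (a + - b)              ≈⟨ +-cong (distribˡ a a (- b)) (distribˡ (- b) a (- b)) ⟩
    (a * a + a * - b) + (- b * a + - b * - b)    ≈⟨ +-cong (+-congˡ (sym (-‿distribʳ-* a b)))
                                                           (+-cong mixed square) ⟩
    (a * a + - (a * b)) + (- (a * b) + b * b)    ≈⟨ regroup (a * a) (b * b) (- (a * b)) ⟩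
    a * a + (b * b + (- (a * b) + - (a * b)))    ≈⟨ +-congˡ (+-congˡ double) ⟩
    a * a + (b * b + - (a + a) * b)              ∎
    where
    mixed : - b * a ≈ - (a * b)
    mixed = trans (sym (-‿distribˡ-* b a)) (-‿cong (*-comm b a))
    square : - b * - b ≈ b * b
    square = begin
      - b * - b      ≈⟨ -‿distribˡ-* b (- b) ⟨
      - (b * - b)    ≈⟨ -‿cong (-‿distribʳ-* b b) ⟨
      - (- (b * b))  ≈⟨ -‿involutive (b * b) ⟩
      b * b          ∎
    double : - (a * b) + - (a * b) ≈ - (a + a) * b
    double = begin
      - (a * b) + - (a * b)  ≈⟨ -‿+-comm (a * b) (a * b) ⟩
      - (a * b + a * b)      ≈⟨ -‿cong (distribʳ b a a) ⟨
      - ((a + a) * b)        ≈⟨ -‿distribˡ-* (a + a) b ⟩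
      - (a + a) * b          ∎
    regroup : ∀ A B N → (A + N) + (N + B) ≈ A + (B + (N + N))
    regroup = solve 3 (λ A B N → (A ⊕ N) ⊕ (N ⊕ B) ⊜ A ⊕ (B ⊕ (N ⊕ N))) refl
      where open +-Solver using (solve; _⊜_; _⊕_)

  square-of-difference-swap : ∀ a b → (a + - b) * (a + - b) ≈ (b + - a) * (b + - a)
  square-of-difference-swap a b = begin
    (a + - b) * (a + - b)           ≈⟨ square-of-difference a b ⟩
    a * a + (b * b + - (a + a) * b) ≈⟨ +-congˡ (+-congˡ double-comm) ⟩
    a * a + (b * b + - (b + b) * a) ≈⟨ swap (a * a) (b * b) (- (b + b) * a) ⟩
    b * b + (a * a + - (b + b) * a) ≈⟨ square-of-difference b a ⟨
    (b + - a) * (b + - a)           ∎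
    where
    double-comm : - (a + a) * b ≈ - (b + b) * a
    double-comm = trans (sym (-‿distribˡ-* (a + a) b)) (trans (-‿cong (begin
      (a + a) * b    ≈⟨ distribʳ b a a ⟩
      a * b + a * b  ≈⟨ +-cong (*-comm a b) (*-comm a b) ⟩
      b * a + b * a  ≈⟨ distribʳ a b b ⟨
      (b + b) * a    ∎)) (-‿distribˡ-* (b + b) a))
    swap : ∀ A B N → A + (B + N) ≈ B + (A + N)
    swap = solve 3 (λ A B N → A ⊕ (B ⊕ N) ⊜ B ⊕ (A ⊕ N)) refl
      where open +-Solver using (solve; _⊜_; _⊕_)

  dist²-sym : ∀ x y → dist² x y ≈ dist² y x
  dist²-sym x y = sum-cong-≋ λ k → square-of-difference-swap (x k) (y k)

  dist²-cong : ∀ {x x′ y y′} → x ≋ x′ → y ≋ y′ → dist² x y ≈ dist² x′ y′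
  dist²-cong x≋x′ y≋y′ = sum-cong-≋ λ k → *-cong (difference k) (difference k)
    where difference = λ k → +-cong (x≋x′ k) (-‿cong (y≋y′ k))

  dist²-self : ∀ x → dist² x x ≈ 0#
  dist²-self x = sum-zero λ k → trans (*-congʳ (-‿inverseʳ (x k))) (zeroˡ _)

  -- Lifting points to vectors of length m+2: P(x) = (‖x‖², 1, −2x) and Z(y) = (1, ‖y‖², y)
  -- pair to the squared distance of x and y; the border rows (1, 0, 0) and (0, 1, 0)
  -- pair to 1 with those and to 0 with each other.
  P-row Z-row : (Fin (suc m) → Pt) → Maybe (Fin (suc m)) → Vector Carrier (suc (suc m))
  P-row v (just a) = ‖ v a ‖² ∷ 1# ∷ λ k → - (v a k + v a k)
  P-row v nothing  = 1# ∷ 0# ∷ λ _ → 0#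
  Z-row v (just b) = 1# ∷ ‖ v b ‖² ∷ v b
  Z-row v nothing  = 0# ∷ 1# ∷ λ _ → 0#

  -- The bordered matrix of squared distances from the points u₀,…,u_m to v₀,…,v_m
  -- (row and column m+1 are the border); for u = v it is the Cayley–Menger matrix.
  entry : (u v : Fin (suc m) → Pt) → Maybe (Fin (suc m)) → Maybe (Fin (suc m)) → Carrier
  entry u v (just a) (just b) = dist² (u a) (v b)
  entry u v (just _) nothing  = 1#
  entry u v nothing  (just _) = 1#
  entry u v nothing  nothing  = 0#

  pairing : ∀ u v mi mj → sum (λ c → P-row u mi c * Z-row v mj c) ≈ entry u v mi mj
  pairing u v (just a) (just b) = begin
    ‖ x ‖² * 1# + (1# * ‖ y ‖² + sum λ k → - (x k + x k) * y k)
      ≈⟨ +-cong (*-identityʳ _) (+-congʳ (*-identityˡ _)) ⟩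
    ‖ x ‖² + (‖ y ‖² + sum λ k → - (x k + x k) * y k)
      ≈⟨ +-congˡ (∑-distrib-+ (λ k → y k * y k) (λ k → - (x k + x k) * y k)) ⟨
    ‖ x ‖² + sum (λ k → y k * y k + - (x k + x k) * y k)
      ≈⟨ ∑-distrib-+ (λ k → x k * x k) (λ k → y k * y k + - (x k + x k) * y k) ⟨
    sum (λ k → x k * x k + (y k * y k + - (x k + x k) * y k))
      ≈⟨ sum-cong-≋ (λ k → square-of-difference (x k) (y k)) ⟨
    dist² x y ∎
    where
    x = u a
    y = v b
  pairing u v (just a) nothing =
    trans (+-cong (zeroʳ _) (+-cong (*-identityˡ 1#) (sum-zero λ k → zeroʳ (- (u a k + u a k)))))
          (trans (+-identityˡ _) (+-identityʳ 1#))
  pairing u v nothing (just b) =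
    trans (+-cong (*-identityˡ 1#) (+-cong (zeroˡ _) (sum-zero λ k → zeroˡ (v b k))))
          (trans (+-congˡ (+-identityˡ 0#)) (+-identityʳ 1#))
  pairing u v nothing nothing =
    trans (+-cong (zeroʳ 1#) (+-cong (zeroˡ 1#) (sum-zero {m} λ k → zeroˡ 0#)))
          (trans (+-identityˡ _) (+-identityˡ 0#))

  P Z : (Fin (suc m) → Pt) → Matrix (suc (suc m))
  P v i = P-row v (initIdx i)
  Z v i = Z-row v (initIdx i)

  bordered : (u v : Fin (suc m) → Pt) → Matrix (suc (suc m))
  bordered u v i j = entry u v (initIdx i) (initIdx j)

  -- The bordered matrix is P(u)·Z(v)ᵀ, hence its determinant factorises.
  bordered-factorises : ∀ u v → Det (bordered u v) ≈ Det (P u) * Det (Z v)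
  bordered-factorises u v =
    trans (det-cong λ i j → sym (pairing u v (initIdx i) (initIdx j))) (det-·ᵀ (P u) (Z v))

  bordered-transpose : ∀ u v → bordered u v ≋ᴹ (bordered v u) ᵀ
  bordered-transpose u v i j = symmetric (initIdx i) (initIdx j)
    where
    symmetric : ∀ mi mj → entry u v mi mj ≈ entry v u mj mi
    symmetric (just a) (just b) = dist²-sym (u a) (v b)
    symmetric (just _) nothing  = refl
    symmetric nothing  (just _) = refl
    symmetric nothing  nothing  = refl

  -- For two families u, v:  det B(u,u)·det B(v,v) = det P(u) det Z(u) det P(v) det Z(v)
  -- = det B(v,u)·det B(u,v) = (det B(v,u))².
  bordered-product : ∀ u v →
    Det (bordered u u) * Det (bordered v v) ≈ Det (bordered v u) * Det (bordered v u)
  bordered-product u v = begin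
    Det (bordered u u) * Det (bordered v v)
      ≈⟨ *-cong (bordered-factorises u u) (bordered-factorises v v) ⟩
    (Det (P u) * Det (Z u)) * (Det (P v) * Det (Z v))
      ≈⟨ regroup (Det (P u)) (Det (Z u)) (Det (P v)) (Det (Z v)) ⟩
    (Det (P v) * Det (Z u)) * (Det (P u) * Det (Z v))
      ≈⟨ *-cong (bordered-factorises v u) (bordered-factorises u v) ⟨
    Det (bordered v u) * Det (bordered u v)
      ≈⟨ *-congˡ (trans (det-cong (bordered-transpose u v)) (det-transpose (bordered v u))) ⟩
    Det (bordered v u) * Det (bordered v u) ∎
    where
    regroup : ∀ a b c d → (a * b) * (c * d) ≈ (c * b) * (a * d)
    regroup = solve 4 (λ a b c d → (a ⊕ b) ⊕ (c ⊕ d) ⊜ (c ⊕ b) ⊕ (a ⊕ d)) refl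
      where open ×-Solver using (solve; _⊜_; _⊕_)

coarsen : ∀ {A : Set} {add mul : Op₂ A} {neg : Op₁ A} {0# 1# : A} {_~_ : Rel A 0ℓ} →
          IsCommutativeRing _≡_ add mul neg 0# 1# → IsEquivalence _~_ →
          Congruent₂ _~_ add → Congruent₂ _~_ mul → Congruent₁ _~_ neg →
          IsCommutativeRing _~_ add mul neg 0# 1#
coarsen ring equiv add-cong mul-cong neg-cong = record
  { isRing = record
    { +-isAbelianGroup = record
      { isGroup = record
        { isMonoid = record
          { isSemigroup = record
            { isMagma = record { isEquivalence = equiv ; ∙-cong = add-cong }
            ; assoc   = λ x y z → lift (+-assoc x y z)
            }
          ; identity = (λ x → lift (+-identityˡ x)) , (λ x → lift (+-identityʳ x))
          }
        ; inverse = (λ x → lift (-‿inverseˡ x)) , (λ x → lift (-‿inverseʳ x))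
        ; ⁻¹-cong = neg-cong
        }
      ; comm = λ x y → lift (+-comm x y)
      }
    ; *-cong     = mul-cong
    ; *-assoc    = λ x y z → lift (*-assoc x y z)
    ; *-identity = (λ x → lift (*-identityˡ x)) , (λ x → lift (*-identityʳ x))
    ; distrib    = (λ x y z → lift (distribˡ x y z)) , (λ x y z → lift (distribʳ x y z))
    }
  ; *-comm = λ x y → lift (*-comm x y)
  }
  where
  open IsCommutativeRing ring using (+-assoc; +-identityˡ; +-identityʳ; -‿inverseˡ; -‿inverseʳ; +-comm;
    *-assoc; *-identityˡ; *-identityʳ; distribˡ; distribʳ; *-comm)
  lift = IsEquivalence.reflexive equiv

module Squares {c ℓ} (R : CommutativeRing c ℓ) where

  open CommutativeRing R
  open import Algebra.Solver.CommutativeMonoid *-commutativeMonoid using (solve; _⊜_; _⊕_)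
  open import Relation.Binary.Reasoning.Setoid setoid

  square-quotient : ∀ {A B s t u} → A * B ≈ t * t → A ≈ s * s → s * u ≈ 1# → B ≈ (t * u) * (t * u)
  square-quotient {A} {B} {s} {t} {u} AB≈t² A≈s² su≈1 = begin
    B                         ≈⟨ *-identityˡ B ⟨
    1# * B                    ≈⟨ *-congʳ (*-identityˡ 1#) ⟨
    (1# * 1#) * B             ≈⟨ *-congʳ (*-cong su≈1 su≈1) ⟨
    ((s * u) * (s * u)) * B   ≈⟨ regroup s u B ⟩
    ((s * s) * B) * (u * u)   ≈⟨ *-congʳ (*-congʳ A≈s²) ⟨
    (A * B) * (u * u)         ≈⟨ *-congʳ AB≈t² ⟩
    (t * t) * (u * u)         ≈⟨ interchange t u ⟩
    (t * u) * (t * u)         ∎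
    where
    regroup : ∀ s u B → ((s * u) * (s * u)) * B ≈ ((s * s) * B) * (u * u)
    regroup = solve 3 (λ s u B → ((s ⊕ u) ⊕ (s ⊕ u)) ⊕ B ⊜ ((s ⊕ s) ⊕ B) ⊕ (u ⊕ u)) refl
    interchange : ∀ t u → (t * t) * (u * u) ≈ (t * u) * (t * u)
    interchange = solve 2 (λ t u → (t ⊕ t) ⊕ (u ⊕ u) ⊜ (t ⊕ u) ⊕ (t ⊕ u)) refl

module Modular (p : ℕ) where

  open import Data.Integer using (_+_; _-_; _*_; -_; ∣_∣)

  -- congruence modulo p, as a record so that both sides can be inferred
  infix 4 _≡ₚ_
  record _≡ₚ_ (a b : ℤ) : Set where
    constructor mod-p
    field divisible : a ≈[ p ] b
  open _≡ₚ_ public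

  infix 4 _≡ₚ?_
  _≡ₚ?_ : Decidable _≡ₚ_
  a ≡ₚ? b = Dec.map′ mod-p divisible (p ∣? ∣ a - b ∣)

  by-multiple : ∀ {a b} q → a - b ≡ q * + p → a ≡ₚ b
  by-multiple q eq = mod-p (Signed.∣⇒∣ᵤ (Signed.divides q eq))

  private
    multiple : ∀ {a b} → a ≡ₚ b → (+ p) Signed.∣ (a - b)
    multiple a≡b = Signed.∣ᵤ⇒∣ (divisible a≡b)

    combine : ∀ {a b x} → a - b ≡ x → (+ p) Signed.∣ x → a ≡ₚ b
    combine eq (Signed.divides q x≡qp) = by-multiple q (≡.trans eq x≡qp)

  ≡ₚ-isEquivalence : IsEquivalence _≡ₚ_
  ≡ₚ-isEquivalence = record
    { refl  = λ {a} → by-multiple (+ 0) (≡.trans (ℤP.+-inverseʳ a) (≡.sym (ℤP.*-zeroˡ (+ p))))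
    ; sym   = λ {a} {b} a≡b → combine (flip a b) (Signed.∣m⇒∣-m (multiple a≡b))
    ; trans = λ {a} {b} {c} a≡b b≡c →
                combine (chain a b c) (Signed.∣m∣n⇒∣m+n (multiple a≡b) (multiple b≡c))
    }
    where
    flip : ∀ a b → b - a ≡ - (a - b)
    flip = solve-∀
    chain : ∀ a b c → a - c ≡ (a - b) + (b - c)
    chain = solve-∀

  +-cong : Congruent₂ _≡ₚ_ _+_
  +-cong {a} {b} {c} {d} a≡b c≡d =
    combine (split a b c d) (Signed.∣m∣n⇒∣m+n (multiple a≡b) (multiple c≡d))
    where
    split : ∀ a b c d → (a + c) - (b + d) ≡ (a - b) + (c - d)
    split = solve-∀

  *-cong : Congruent₂ _≡ₚ_ _*_
  *-cong {a} {b} {c} {d} a≡b c≡d =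
    combine (split a b c d)
            (Signed.∣m∣n⇒∣m+n (Signed.∣n⇒∣m*n a (multiple c≡d)) (Signed.∣m⇒∣m*n d (multiple a≡b)))
    where
    split : ∀ a b c d → a * c - b * d ≡ a * (c - d) + (a - b) * d
    split = solve-∀

  -‿cong : ∀ {a b} → a ≡ₚ b → - a ≡ₚ - b
  -‿cong {a} {b} a≡b = combine (split a b) (Signed.∣m⇒∣-m (multiple a≡b))
    where
    split : ∀ a b → - a - - b ≡ - (a - b)
    split = solve-∀

  ℤₚ : CommutativeRing 0ℓ 0ℓ
  ℤₚ = record
    { isCommutativeRing = coarsen ℤP.+-*-isCommutativeRing ≡ₚ-isEquivalence +-cong *-cong -‿cong }

  open CommutativeRing ℤₚ using ()
    renaming (refl to ≡ₚ-refl; sym to ≡ₚ-sym; trans to ≡ₚ-trans; reflexive to ≡⇒≡ₚ)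

  private
    in-ℤ : ∀ a b c d e → a ℕ.+ b ℕ.* c ≡ d ℕ.* e → + a + + b * + c ≡ + d * + e
    in-ℤ a b c d e eq = ≡.trans (≡.sym (≡.trans (ℤP.pos-+ a (b ℕ.* c)) (≡.cong (λ x → + a + x) (ℤP.pos-* b c))))
                                (≡.trans (≡.cong +_ eq) (ℤP.pos-* d e))

  invert-below : Prime p → ∀ r .{{_ : NonZero r}} → r ℕ.< p → ∃ λ u → + r * u ≡ₚ + 1
  invert-below pr r r<p with coprime-Bézout (prime⇒coprime pr r<p)
  ... | Bézout.+- x y eq = - (+ y) , by-multiple (- (+ x)) (begin
    + r * - (+ y) - + 1    ≡⟨ negate (+ r) (+ y) ⟩
    - (+ 1 + + y * + r)    ≡⟨ ≡.cong -_ (in-ℤ 1 y r x p eq) ⟩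
    - (+ x * + p)          ≡⟨ ℤP.neg-distribˡ-* (+ x) (+ p) ⟩
    - (+ x) * + p          ∎)
    where
    open ≡.≡-Reasoning
    negate : ∀ r y → r * - y - + 1 ≡ - (+ 1 + y * r)
    negate = solve-∀
  ... | Bézout.-+ x y eq = + y , by-multiple (+ x) (begin
    + r * + y - + 1        ≡⟨ reorder (+ r) (+ y) ⟩
    + y * + r - + 1        ≡⟨ ≡.cong (_- + 1) (in-ℤ 1 x p y r eq) ⟨
    + 1 + + x * + p - + 1  ≡⟨ cancel (+ x) (+ p) ⟩
    + x * + p              ∎)
    where
    open ≡.≡-Reasoning
    reorder : ∀ r y → r * y - + 1 ≡ y * r - + 1
    reorder = solve-∀
    cancel : ∀ x p → + 1 + x * p - + 1 ≡ x * p
    cancel = solve-∀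

  -- Every residue not divisible by p is invertible: invert its remainder modulo p.
  inverse : Prime p → ∀ s → ¬ (s ≡ₚ + 0) → ∃ λ u → s * u ≡ₚ + 1
  inverse pr s s≢0 = proj₁ r-inverse , ≡ₚ-trans (*-cong s≡r ≡ₚ-refl) (proj₂ r-inverse)
    where
    instance
      p≢0 : NonZero p
      p≢0 = prime⇒nonZero pr
    r = s %ℕ p
    s≡r : s ≡ₚ + r
    s≡r = by-multiple (s /ℕ p) (≡.trans (≡.cong (_- + r) (a≡a%ℕn+[a/ℕn]*n s p)) (cancel (+ r) (s /ℕ p) (+ p)))
      where
      cancel : ∀ b q P → b + q * P - b ≡ q * P
      cancel = solve-∀
    instance
      r≢0 : NonZero r
      r≢0 = ≢-nonZero λ r≡0 → s≢0 (≡ₚ-trans s≡r (≡⇒≡ₚ (≡.cong +_ r≡0)))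
    r-inverse = invert-below pr r (n%ℕd<d s p)

  open Squares ℤₚ using (square-quotient)

  residue-transfer : Prime p → ∀ {A B t} → ¬ (B ≈[ p ] + 0) → (A * B) ≈[ p ] (t * t) →
                     QR p A → QR p B
  residue-transfer pr {A} {B} {t} B≢0 AB≡t² (A≢0 , s , s²≡A) =
    B≢0 , t * u , divisible (≡ₚ-sym (square-quotient {A} {B} {s} {t} {u} (mod-p AB≡t²) (≡ₚ-sym (mod-p s²≡A)) su≡1))
    where
    -- s² ≡ A ≢ 0, so s is invertible
    s≢0 : ¬ (s ≡ₚ + 0)
    s≢0 s≡0 = A≢0 (divisible (≡ₚ-trans (≡ₚ-sym (mod-p s²≡A)) (*-cong s≡0 s≡0)))
    u = proj₁ (inverse pr s s≢0)
    su≡1 = proj₂ (inverse pr s s≢0)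

  characteristics-agree : Prime p → ∀ {A B t α c d} → ¬ (A ≈[ p ] + 0) → ¬ (B ≈[ p ] + 0) →
    (A * B) ≈[ p ] (t * t) →
    (QR p A × c ≡ 1) ⊎ (¬ QR p A × c ≡ α) → (QR p B × d ≡ 1) ⊎ (¬ QR p B × d ≡ α) → c ≡ d
  characteristics-agree pr A≢0 B≢0 AB≡t² (inj₁ (_ , ≡.refl)) (inj₁ (_ , ≡.refl)) = ≡.refl
  characteristics-agree pr A≢0 B≢0 AB≡t² (inj₂ (_ , ≡.refl)) (inj₂ (_ , ≡.refl)) = ≡.refl
  characteristics-agree pr {t = t} A≢0 B≢0 AB≡t² (inj₁ (qrA , _)) (inj₂ (¬qrB , _)) =
    ⊥-elim (¬qrB (residue-transfer pr {t = t} B≢0 AB≡t² qrA))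
  characteristics-agree pr {A} {B} {t} A≢0 B≢0 AB≡t² (inj₂ (¬qrA , _)) (inj₁ (qrB , _)) =
    ⊥-elim (¬qrA (residue-transfer pr {t = t} A≢0 BA≡t² qrB))
    where BA≡t² = divisible (≡ₚ-trans (≡⇒≡ₚ (ℤP.*-comm B A)) (mod-p AB≡t²))

module QuadraticExtension (p α : ℕ) where

  open Modular p using (_≡ₚ_; ℤₚ)
  private module ℤp = CommutativeRing ℤₚ

  negK : K → K
  negK (a , b) = (ℤ.- a , ℤ.- b)

  ℤ[√α] : IsCommutativeRing _≡_ _+K_ (mulK α) negK (ι (+ 0)) (ι (+ 1))
  ℤ[√α] = record
    { isRing = record
      { +-isAbelianGroup = record
        { isGroup = record
          { isMonoid = record
            { isSemigroup = record
              { isMagma = record { isEquivalence = ≡.isEquivalence ; ∙-cong = cong₂ _+K_ }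
              ; assoc   = λ x y z → cong₂ _,_ (ℤP.+-assoc (proj₁ x) (proj₁ y) (proj₁ z))
                                              (ℤP.+-assoc (proj₂ x) (proj₂ y) (proj₂ z))
              }
            ; identity = (λ x → cong₂ _,_ (ℤP.+-identityˡ (proj₁ x)) (ℤP.+-identityˡ (proj₂ x)))
                       , (λ x → cong₂ _,_ (ℤP.+-identityʳ (proj₁ x)) (ℤP.+-identityʳ (proj₂ x)))
            }
          ; inverse = (λ x → cong₂ _,_ (ℤP.+-inverseˡ (proj₁ x)) (ℤP.+-inverseˡ (proj₂ x)))
                    , (λ x → cong₂ _,_ (ℤP.+-inverseʳ (proj₁ x)) (ℤP.+-inverseʳ (proj₂ x)))
          ; ⁻¹-cong = ≡.cong negK
          }
        ; comm = λ x y → cong₂ _,_ (ℤP.+-comm (proj₁ x) (proj₁ y)) (ℤP.+-comm (proj₂ x) (proj₂ y))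
        }
      ; *-cong     = cong₂ (mulK α)
      ; *-assoc    = λ { (a , b) (c , d) (e , f) → cong₂ _,_ (assoc₁ (+ α) a b c d e f) (assoc₂ (+ α) a b c d e f) }
      ; *-identity = (λ { (a , b) → cong₂ _,_ (identity₁ (+ α) a b) (identity₂ a b) })
                   , (λ { (a , b) → cong₂ _,_ (identity₃ (+ α) a b) (identity₄ a b) })
      ; distrib    = (λ { (a , b) (c , d) (e , f) → cong₂ _,_ (distrib₁ (+ α) a b c d e f) (distrib₂ a b c d e f) })
                   , (λ { (a , b) (c , d) (e , f) → cong₂ _,_ (distrib₃ (+ α) a b c d e f) (distrib₄ a b c d e f) })
      }
    ; *-comm = λ { (a , b) (c , d) → cong₂ _,_ (comm₁ (+ α) a b c d) (comm₂ a b c d) }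
    }
    where
    open import Data.Integer using (_+_; _*_)
    assoc₁ : ∀ A a b c d e f → (a * c + A * (b * d)) * e + A * ((a * d + b * c) * f)
                             ≡ a * (c * e + A * (d * f)) + A * (b * (c * f + d * e))
    assoc₁ = solve-∀
    assoc₂ : ∀ A a b c d e f → (a * c + A * (b * d)) * f + (a * d + b * c) * e
                             ≡ a * (c * f + d * e) + b * (c * e + A * (d * f))
    assoc₂ = solve-∀
    identity₁ : ∀ A a b → + 1 * a + A * (+ 0 * b) ≡ a
    identity₁ = solve-∀
    identity₂ : ∀ a b → + 1 * b + + 0 * a ≡ b
    identity₂ = solve-∀
    identity₃ : ∀ A a b → a * + 1 + A * (b * + 0) ≡ a
    identity₃ = solve-∀
    identity₄ : ∀ a b → a * + 0 + b * + 1 ≡ b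
    identity₄ = solve-∀
    distrib₁ : ∀ A a b c d e f → a * (c + e) + A * (b * (d + f))
                               ≡ (a * c + A * (b * d)) + (a * e + A * (b * f))
    distrib₁ = solve-∀
    distrib₂ : ∀ a b c d e f → a * (d + f) + b * (c + e) ≡ (a * d + b * c) + (a * f + b * e)
    distrib₂ = solve-∀
    distrib₃ : ∀ A a b c d e f → (c + e) * a + A * ((d + f) * b)
                               ≡ (c * a + A * (d * b)) + (e * a + A * (f * b))
    distrib₃ = solve-∀
    distrib₄ : ∀ a b c d e f → (c + e) * b + (d + f) * a ≡ (c * b + d * a) + (e * b + f * a)
    distrib₄ = solve-∀
    comm₁ : ∀ A a b c d → a * c + A * (b * d) ≡ c * a + A * (d * b)
    comm₁ = solve-∀
    comm₂ : ∀ a b c d → a * d + b * c ≡ c * b + d * a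
    comm₂ = solve-∀

  -- Componentwise congruence modulo p; ℤ_p(√α) is ℤ[√α] with this equality.
  infix 4 _≈ₚ_
  record _≈ₚ_ (x y : K) : Set where
    constructor _,_
    field
      re : proj₁ x ≡ₚ proj₁ y
      im : proj₂ x ≡ₚ proj₂ y
  open _≈ₚ_ public

  Kₚ : CommutativeRing 0ℓ 0ℓ
  Kₚ = record { isCommutativeRing = coarsen ℤ[√α] ≈ₚ-isEquivalence
    (λ x≈y u≈v → ℤp.+-cong (re x≈y) (re u≈v) , ℤp.+-cong (im x≈y) (im u≈v))
    (λ x≈y u≈v → ℤp.+-cong (ℤp.*-cong (re x≈y) (re u≈v))
                            (ℤp.*-cong (ℤp.refl {+ α}) (ℤp.*-cong (im x≈y) (im u≈v)))
               , ℤp.+-cong (ℤp.*-cong (re x≈y) (im u≈v)) (ℤp.*-cong (im x≈y) (re u≈v)))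
    (λ x≈y → ℤp.-‿cong (re x≈y) , ℤp.-‿cong (im x≈y)) }
    where
    ≈ₚ-isEquivalence : IsEquivalence _≈ₚ_
    ≈ₚ-isEquivalence = record
      { refl  = ℤp.refl , ℤp.refl
      ; sym   = λ x≈y → ℤp.sym (re x≈y) , ℤp.sym (im x≈y)
      ; trans = λ x≈y y≈z → ℤp.trans (re x≈y) (re y≈z) , ℤp.trans (im x≈y) (im y≈z)
      }

  open CommutativeRing Kₚ hiding (zero)
  open Determinant Kₚ
  open import Algebra.Properties.Semiring.Sum semiring using (sum; sum-cong-≋)

  -- The embedding ι : ℤ → ℤ_p(√α) is a ring homomorphism, so it commutes with determinants.
  ι-* : ∀ a b → ι (a ℤ.* b) ≈ ι a * ι b
  ι-* a b = reflexive (cong₂ _,_ (real a b (+ α)) (imaginary a b))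
    where
    real : ∀ a b A → a ℤ.* b ≡ a ℤ.* b ℤ.+ A ℤ.* (+ 0 ℤ.* + 0)
    real = solve-∀
    imaginary : ∀ a b → + 0 ≡ a ℤ.* + 0 ℤ.+ + 0 ℤ.* b
    imaginary = solve-∀

  ι-sum : ∀ {n} (f : Fin n → ℤ) → ι (sumℤ f) ≡ sum (λ i → ι (f i))
  ι-sum {zero}  f = ≡.refl
  ι-sum {suc n} f = ≡.cong (_+_ (ι (f zero))) (ι-sum (λ i → f (suc i)))

  ι-sign : ∀ k → ι (sign k) ≡ sgn k
  ι-sign zero    = ≡.refl
  ι-sign (suc k) = ≡.cong -_ (ι-sign k)

  ι-det : ∀ n (M : Fin n → Fin n → ℤ) → ι (det n M) ≈ Det (λ i j → ι (M i j))
  ι-det zero    M = refl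
  ι-det (suc n) M =
    trans (reflexive (ι-sum term)) (sum-cong-≋ λ j →
      trans (ι-* (sign (toℕ j)) _)
            (*-cong (reflexive (ι-sign (toℕ j)))
                    (trans (ι-* (M zero j) _) (*-congˡ {ι (M zero j)} (ι-det n (minor′ j))))))
    where
    minor′ : Fin (suc n) → Fin n → Fin n → ℤ
    minor′ j r c = M (suc r) (punchIn j c)
    term : Fin (suc n) → ℤ
    term j = sign (toℕ j) ℤ.* (M zero j ℤ.* det n (minor′ j))

module CayleyMenger (p α m : ℕ) (𝒫 : Point m → Set) (δ : Point m → Point m → ℤ)
                    (integral : IsIntegralPointSet p α m 𝒫 δ) where

  open Modular p using (_≡ₚ_; mod-p; divisible; _≡ₚ?_; ℤₚ)
  open QuadraticExtension p α
  open CommutativeRing Kₚ hiding (zero)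
  open CommutativeRing ℤₚ using () renaming (refl to ≡ₚ-refl)
  open Determinant Kₚ
  open Lifting Kₚ m
  open IsIntegralPointSet integral
  open import Algebra.Properties.Semiring.Sum semiring using (sum)
  open import Relation.Binary.Reasoning.Setoid setoid

  fromK : ∀ {x y} → x ≈K[ p ] y → x ≈ y
  fromK (re , im) = mod-p re , mod-p im

  sumK-sum : ∀ {n} (f : Fin n → K) → sumK f ≡ sum f
  sumK-sum {zero}  f = ≡.refl
  sumK-sum {suc n} f = ≡.cong (_+_ (f zero)) (sumK-sum (λ i → f (suc i)))

  sqDist-dist² : ∀ x y → sqDist α {m} x y ≈ dist² x y
  sqDist-dist² x y = reflexive (sumK-sum (λ k → mulK α (x k -K y k) (x k -K y k)))

  -- Squared distances between points of 𝒫 lie in ℤ_p: their √α-component vanishes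
  -- (it is that of 0 if x ≈ y and that of δ(x,y)² otherwise; the case distinction is
  -- legitimate because congruence modulo p is decidable).
  distance-rational : ∀ x y → 𝒫 x → 𝒫 y → proj₂ (dist² x y) ≡ₚ + 0
  distance-rational x y x∈𝒫 y∈𝒫 = decidable-stable (proj₂ (dist² x y) ≡ₚ? + 0) λ im≢0 →
    im≢0 (im (square-of-δ λ x≈y → im≢0 (im (coincide x≈y))))
    where
    coincide : x ≈P[ p ] y → dist² x y ≈ 0#
    coincide x≈y = trans (dist²-cong {x} {x} {y} {x} (λ _ → refl) (λ k → sym (fromK {x k} {y k} (x≈y k))))
                         (dist²-self x)
    square-of-δ : ¬ (x ≈P[ p ] y) → dist² x y ≈ ι (δ x y ℤ.* δ x y)
    square-of-δ x≉y = trans (sym (sqDist-dist² x y)) (fromK {sqDist α x y} (δ-distance x y x∈𝒫 y∈𝒫 x≉y))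

  bordered-rational : ∀ {u v} → (∀ a → 𝒫 (u a)) → (∀ b → 𝒫 (v b)) →
                      bordered u v ≋ᴹ λ i j → ι (proj₁ (bordered u v i j))
  bordered-rational {u} {v} u∈𝒫 v∈𝒫 i j = rational (initIdx i) (initIdx j)
    where
    rational : ∀ mi mj → entry u v mi mj ≈ ι (proj₁ (entry u v mi mj))
    rational (just a) (just b) = ≡ₚ-refl , distance-rational (u a) (v b) (u∈𝒫 a) (v∈𝒫 b)
    rational (just _) nothing  = refl
    rational nothing  (just _) = refl
    rational nothing  nothing  = refl

  cayley-menger : ∀ {v} → IsSimplex p 𝒫 v → (λ i j → ι (CM δ v i j)) ≋ᴹ bordered v v
  cayley-menger {v} (v∈𝒫 , distinct) i j with initIdx i | initIdx j
  ... | just a  | just b with a Fin.≟ b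
  ...   | yes ≡.refl = trans (ι-* (δ (v a) (v a)) (δ (v a) (v a)))
                      (trans (*-cong δ-vanishes δ-vanishes) (trans (zeroˡ 0#) (sym (dist²-self (v a)))))
    where
    δ-vanishes : ι (δ (v a) (v a)) ≈ 0#
    δ-vanishes = mod-p (δ-self (v a)) , ≡ₚ-refl
  ...   | no a≢b = trans (sym (fromK {sqDist α (v a) (v b)} (δ-distance (v a) (v b) (v∈𝒫 a) (v∈𝒫 b) a≉b)))
                         (sqDist-dist² (v a) (v b))
    where a≉b = distinct a b a≢b
  cayley-menger (v∈𝒫 , distinct) i j | just _  | nothing = refl
  cayley-menger (v∈𝒫 , distinct) i j | nothing | just _  = refl
  cayley-menger (v∈𝒫 , distinct) i j | nothing | nothing = refl

  -- The product of the Cayley–Menger determinants of two simplices v, w of 𝒫 is a square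
  -- modulo p: it is (det B(w,v))², and det B(w,v) lies in ℤ_p.
  product-is-square : ∀ {v w} → IsSimplex p 𝒫 v → IsSimplex p 𝒫 w →
                      ∃ λ t → (Vsq δ v ℤ.* Vsq δ w) ≈[ p ] (t ℤ.* t)
  product-is-square {v} {w} v-simplex w-simplex = t , divisible (re square)
    where
    n = suc (suc m)
    t = det n (λ i j → proj₁ (bordered w v i j))
    volume : ∀ {u} → IsSimplex p 𝒫 u → ι (Vsq δ u) ≈ Det (bordered u u)
    volume {u} u-simplex = begin
      ι (Vsq δ u)                    ≈⟨ ι-det n (CM δ u) ⟩
      Det (λ i j → ι (CM δ u i j))   ≈⟨ det-cong {M = λ i j → ι (CM δ u i j)} {N = bordered u u} (cayley-menger u-simplex) ⟩
      Det (bordered u u)             ∎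
    rational : Det (bordered w v) ≈ ι t
    rational = begin
      Det (bordered w v)                           ≈⟨ det-cong {M = bordered w v} {N = λ i j → ι (proj₁ (bordered w v i j))}
                                                                (bordered-rational (proj₁ w-simplex) (proj₁ v-simplex)) ⟩
      Det (λ i j → ι (proj₁ (bordered w v i j)))  ≈⟨ ι-det n (λ i j → proj₁ (bordered w v i j)) ⟨
      ι t                                          ∎
    square : ι (Vsq δ v ℤ.* Vsq δ w) ≈ ι (t ℤ.* t)
    square = begin
      ι (Vsq δ v ℤ.* Vsq δ w)                  ≈⟨ ι-* (Vsq δ v) (Vsq δ w) ⟩
      ι (Vsq δ v) * ι (Vsq δ w)                ≈⟨ *-cong {ι (Vsq δ v)} {Det (bordered v v)} {ι (Vsq δ w)} {Det (bordered w w)}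
                                                         (volume v-simplex) (volume w-simplex) ⟩
      Det (bordered v v) * Det (bordered w w)  ≈⟨ bordered-product v w ⟩
      Det (bordered w v) * Det (bordered w v)  ≈⟨ *-cong {Det (bordered w v)} {ι t} {Det (bordered w v)} {ι t} rational rational ⟩
      ι t * ι t                                ≈⟨ ι-* t t ⟨
      ι (t ℤ.* t)                              ∎

theorem8 : (p α m : ℕ) → OddPrime p → IsSmallestQNR p α → 1 ≤ m →
           (𝒫 : Point m → Set) (δ : Point m → Point m → ℤ) →
           IsIntegralPointSet p α m 𝒫 δ →
           (v w : Fin (suc m) → Point m) →
           IsSimplex p 𝒫 v → NonDegenerate p δ v →
           IsSimplex p 𝒫 w → NonDegenerate p δ w →
           (c d : ℕ) → HasCharacteristic p α δ v c → HasCharacteristic p α δ w d →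
           c ≡ d
theorem8 p α m (p-prime , _) _ _ 𝒫 δ integral v w v-simplex v-nondeg w-simplex w-nondeg c d v-char w-char =
  characteristics-agree p-prime {Vsq δ v} {Vsq δ w} {t} v-nondeg w-nondeg Vv·Vw≡t² v-char w-char
  where
  open Modular p using (characteristics-agree)
  open CayleyMenger p α m 𝒫 δ integral using (product-is-square)
  t = proj₁ (product-is-square v-simplex w-simplex)
  Vv·Vw≡t² = proj₂ (product-is-square v-simplex w-simplex)
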